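{- Let $T$ be a tree that is uniquely distinguishing colorable and satisfies $\chi_D(T)\geq 3$. Then $T$ is a star graph.
   Context: A distinguishing $k$-coloring of a graph $G$ is a partition of $V(G)$ into exactly $k$ non-empty independent sets such that the only automorphism of $G$ mapping every class onto itself is the identity. $\chi_D(G)$ is the least such $k$. $G$ is uniquely distinguishing colorable if there is exactly one partition of $V(G)$ into $\chi_D(G)$ classes forming a distinguishing coloring. -}

module Defs where

open import Data.Nat using (ℕ; zero; suc; _<_; _≤_; NonZero)
open import Data.Nat.DivMod using (_%_; m%n<n)
open import Data.Fin using (Fin; toℕ; fromℕ<)
open import Data.Bool using (Bool; true; false)
open import Data.Product using (Σ; ∃; _×_; _,_)
open import Data.Sum using (_⊎_)
open import Relation.Nullary using (¬_)
open import Relation.Binary.PropositionalEquality using (_≡_; _≢_)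
open import Function.Definitions using (Injective; Surjective)

record Graph (n : ℕ) : Set where
  field
    adj   : Fin n → Fin n → Bool
    sym   : ∀ i j → adj i j ≡ adj j i
    irrefl : ∀ i → adj i i ≡ false
open Graph public

Adj : ∀ {n} → Graph n → Fin n → Fin n → Set
Adj G i j = adj G i j ≡ true

data Walk {n} (G : Graph n) : Fin n → Fin n → Set where
  here : ∀ {u} → Walk G u u
  step : ∀ {u v w} → Adj G u v → Walk G v w → Walk G u w

Connected : ∀ {n} → Graph n → Set
Connected G = ∀ u v → Walk G u v

-- Cycle of length k ≥ 3: k distinct vertices, cyclically consecutive ones adjacent.
succMod : (k : ℕ) → .{{_ : NonZero k}} → Fin k → Fin k
succMod k i = fromℕ< (m%n<n (suc (toℕ i)) k)

HasCycle : ∀ {n} → Graph n → Set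
HasCycle {n} G = Σ ℕ λ m → Σ (Fin (suc (suc (suc m))) → Fin n) λ f →
  Injective _≡_ _≡_ f × (∀ i → Adj G (f i) (f (succMod (suc (suc (suc m))) i)))

IsTree : ∀ {n} → Graph n → Set
IsTree {n} G = (0 < n) × Connected G × ¬ HasCycle G

record Automorphism {n} (G : Graph n) : Set where
  field
    to    : Fin n → Fin n
    from  : Fin n → Fin n
    to-from : ∀ i → to (from i) ≡ i
    from-to : ∀ i → from (to i) ≡ i
    preserves : ∀ i j → adj G (to i) (to j) ≡ adj G i j
open Automorphism public

-- A k-coloring with exactly k non-empty independent colour classes
-- (class j = preimage of j; surjectivity = all classes non-empty).
record Coloring {n} (G : Graph n) (k : ℕ) : Set where
  field
    col    : Fin n → Fin k
    onto   : ∀ j → Σ (Fin n) λ i → col i ≡ j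
    proper : ∀ i j → Adj G i j → col i ≢ col j
open Coloring public

Distinguishing : ∀ {n} {G : Graph n} {k} → Coloring G k → Set
Distinguishing {n} {G} c = (σ : Automorphism G) →
  (∀ i → col c (to σ i) ≡ col c i) → ∀ i → to σ i ≡ i

HasDistColoring : ∀ {n} → Graph n → ℕ → Set
HasDistColoring G k = Σ (Coloring G k) Distinguishing

ChiD≡ : ∀ {n} → Graph n → ℕ → Set
ChiD≡ G k = HasDistColoring G k × (∀ m → m < k → ¬ HasDistColoring G m)

SamePartition : ∀ {n} {G : Graph n} {k} → Coloring G k → Coloring G k → Set
SamePartition {n} c d = ∀ i j → (col c i ≡ col c j → col d i ≡ col d j) × (col d i ≡ col d j → col c i ≡ col c j)

UniquelyDistColorable : ∀ {n} → Graph n → Set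
UniquelyDistColorable G = Σ ℕ λ k → ChiD≡ G k ×
  ((c d : Coloring G k) → Distinguishing c → Distinguishing d → SamePartition c d)

IsStar : ∀ {n} → Graph n → Set
IsStar {n} G = Σ (Fin n) λ z → ∀ i j →
  (Adj G i j → (i ≡ z ⊎ j ≡ z)) × ((i ≡ z ⊎ j ≡ z) → i ≢ j → Adj G i j)

{-# OPTIONS --safe #-}
module Submission where

-- Let c be a distinguishing colouring with χ_D(T) ≥ 3 colours. Uniqueness makes every automorphism
-- σ permute the classes of c, since c ∘ σ is distinguishing too. It also forbids moving a vertex
-- out of a class it shares into a colour absent from its neighbourhood: the result would be a
-- second distinguishing colouring with a different partition. With three colours such a colour
-- exists at every leaf, so leaves form singleton classes. A tree that is not a star contains a
-- path on four vertices, and a maximal path through it ends in non-adjacent leaves ℓ₁, ℓ₂ with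
-- distinct parents. Merging their classes gives a proper colouring with one colour fewer; an
-- automorphism respecting it but not c maps ℓ₁ to ℓ₂ (or back), hence parent to parent, and then
-- moving the first parent into the class of ℓ₂ contradicts uniqueness. So the merged colouring is
-- distinguishing, contradicting the minimality of χ_D.

open import Defs hiding (sym)
open import Data.Nat using (ℕ; zero; suc; _+_; _∸_; _≤_; _<_; z≤n; s≤s; z<s; s≤s⁻¹)
open import Data.Nat.Properties
  using (≤-refl; ≤-trans; n≤1+n; m≤n+m; +-suc; +-identityʳ; +-cancelˡ-≡; +-∸-assoc; m∸n≤m;
         ∸-monoʳ-<; ∸-cancelˡ-≡; m≤n⇒m<n∨m≡n; <-cmp; <⇒≢; <⇒≱; ≰⇒>; +-monoʳ-≤; ≤-reflexive; m≤n⇒∃[o]m+o≡n)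
open import Data.Nat.DivMod using (_%_; m%n<n; m<n⇒m%n≡m; n%n≡0)
open import Data.Fin using (Fin; toℕ; fromℕ<; punchIn; punchOut)
open import Data.Fin.Properties
  using (_≟_; any?; pigeonhole; toℕ<n; toℕ-fromℕ<; toℕ-injective; punchInᵢ≢i; punchOut-cong;
         punchOut-injective; punchOut-punchIn)
import Data.Bool.Properties as Bool
open import Data.Bool using (true)
open import Data.Product using (Σ; ∃; _×_; _,_; proj₁; proj₂)
open import Data.Sum using (_⊎_; inj₁; inj₂; [_,_]′)
open import Data.Empty using (⊥; ⊥-elim)
open import Data.Vec.Functional using (updateAt)
open import Data.Vec.Functional.Properties using (updateAt-updates; updateAt-minimal)
open import Function using (_∘_; const)
open import Relation.Nullary using (¬_; Dec; yes; no; ¬?; _×-dec_; decidable-stable)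
open import Relation.Binary using (tri<; tri≈; tri>)
open import Relation.Binary.PropositionalEquality
open ≡-Reasoning

module _ {n} (G : Graph n) where

  adj-sym : ∀ {i j} → Adj G i j → Adj G j i
  adj-sym {i} {j} a = trans (Graph.sym G j i) a

  adj⇒≢ : ∀ {i j} → Adj G i j → i ≢ j
  adj⇒≢ {i} a refl with trans (sym a) (irrefl G i)
  ... | ()

  adj? : ∀ i j → Dec (Adj G i j)
  adj? i j = adj G i j Bool.≟ true

module _ {n} {G : Graph n} where

  to-injective : (σ : Automorphism G) → ∀ {i j} → to σ i ≡ to σ j → i ≡ j
  to-injective σ {i} {j} e = begin
    i                ≡⟨ sym (from-to σ i) ⟩
    from σ (to σ i)  ≡⟨ cong (from σ) e ⟩
    from σ (to σ j)  ≡⟨ from-to σ j ⟩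
    j                ∎

  PreservesClasses : ∀ {k} → Coloring G k → Automorphism G → Set
  PreservesClasses c σ = ∀ i → col c (to σ i) ≡ col c i

  pullback : ∀ {k} → Coloring G k → Automorphism G → Coloring G k
  pullback c σ = record
    { col    = col c ∘ to σ
    ; onto   = λ j → let (i , ci≡j) = onto c j in from σ i , trans (cong (col c) (to-from σ i)) ci≡j
    ; proper = λ i j a → proper c (to σ i) (to σ j) (trans (preserves σ i j) a)
    }

  -- If τ preserves the classes of c ∘ σ, then σ τ σ⁻¹ preserves those of c.
  pullback-distinguishing : ∀ {k} (c : Coloring G k) → Distinguishing c →
                            (σ : Automorphism G) → Distinguishing (pullback c σ)
  pullback-distinguishing c dc σ τ τ-pres i = begin
    to τ i                                  ≡⟨ sym (from-to σ (to τ i)) ⟩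
    from σ (to σ (to τ i))                  ≡⟨ cong (λ x → from σ (to σ (to τ x))) (sym (from-to σ i)) ⟩
    from σ (to σ (to τ (from σ (to σ i))))  ≡⟨ cong (from σ) (conjugate-fixes (to σ i)) ⟩
    from σ (to σ i)                         ≡⟨ from-to σ i ⟩
    i                                       ∎
    where
      conjugate-fixes : ∀ x → to σ (to τ (from σ x)) ≡ x
      conjugate-fixes = dc record
        { to = λ x → to σ (to τ (from σ x)) ; from = λ x → to σ (from τ (from σ x))
        ; to-from = λ x → trans (cong (to σ) (trans (cong (to τ) (from-to σ _)) (to-from τ _))) (to-from σ x)
        ; from-to = λ x → trans (cong (to σ) (trans (cong (from τ) (from-to σ _)) (from-to τ _))) (to-from σ x)
        ; preserves = λ x y → begin
            adj G (to σ (to τ (from σ x))) (to σ (to τ (from σ y))) ≡⟨ preserves σ _ _ ⟩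
            adj G (to τ (from σ x)) (to τ (from σ y))               ≡⟨ preserves τ _ _ ⟩
            adj G (from σ x) (from σ y)                             ≡⟨ sym (preserves σ _ _) ⟩
            adj G (to σ (from σ x)) (to σ (from σ y))               ≡⟨ cong₂ (adj G) (to-from σ x) (to-from σ y) ⟩
            adj G x y                                               ∎ }
        λ x → trans (τ-pres (from σ x)) (cong (col c) (to-from σ x))

χD-unique : ∀ {n} {G : Graph n} {k m} → ChiD≡ G k → ChiD≡ G m → k ≡ m
χD-unique {k = k} {m} (dk , minimal-k) (dm , minimal-m) with <-cmp k m
... | tri< k<m _ _ = ⊥-elim (minimal-m k k<m dk)
... | tri≈ _ k≡m _ = k≡m
... | tri> _ _ m<k = ⊥-elim (minimal-k m m<k dm)

UniqueDistPartition : ∀ {n} → Graph n → ℕ → Set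
UniqueDistPartition G k =
  (c d : Coloring G k) → Distinguishing c → Distinguishing d → SamePartition c d

module Recolouring {n} {G : Graph n} {k} (c : Coloring G k) {v w : Fin n} {B : Fin k}
  (w≢v : w ≢ v) (w~v : col c w ≡ col c v) (B-free : ∀ {u} → Adj G v u → col c u ≢ B) where

  recolour : Fin n → Fin k
  recolour = updateAt (col c) v (const B)

  recolour-v : recolour v ≡ B
  recolour-v = updateAt-updates v (col c)

  recolour-off : ∀ {i} → i ≢ v → recolour i ≡ col c i
  recolour-off {i} i≢v = updateAt-minimal i v (col c) i≢v

  -- The class of v stays nonempty because it still contains w.
  recoloured : Coloring G k
  recoloured = record { col = recolour ; onto = onto′ ; proper = proper′ }
    where
      onto′ : ∀ j → Σ (Fin n) λ i → recolour i ≡ j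
      onto′ j with onto c j
      ... | i , ci≡j with i ≟ v
      ...   | yes refl = w , trans (recolour-off w≢v) (trans w~v ci≡j)
      ...   | no i≢v = i , trans (recolour-off i≢v) ci≡j
      proper′ : ∀ i j → Adj G i j → recolour i ≢ recolour j
      proper′ i j a e with i ≟ v | j ≟ v
      ... | yes refl | yes refl = adj⇒≢ G a refl
      ... | yes refl | no j≢v = B-free a (sym (trans (sym recolour-v) (trans e (recolour-off j≢v))))
      ... | no i≢v | yes refl = B-free (adj-sym G a) (trans (sym (recolour-off i≢v)) (trans e recolour-v))
      ... | no i≢v | no j≢v = proper c i j a (trans (sym (recolour-off i≢v)) (trans e (recolour-off j≢v)))

module UniquePartition {n} {G : Graph n} {k} (c : Coloring G k) (dc : Distinguishing c)
  (unique : UniqueDistPartition G k) where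

  private
    C : Fin n → Fin k
    C = col c

  automorphism-respects-classes : (σ : Automorphism G) → ∀ {i j} → C i ≡ C j → C (to σ i) ≡ C (to σ j)
  automorphism-respects-classes σ {i} {j} =
    proj₁ (unique c (pullback c σ) dc (pullback-distinguishing c dc σ) i j)

  recoloured-distinguishing : ∀ {v w B} (w≢v : w ≢ v) (w~v : C w ≡ C v) (B-free : ∀ {u} → Adj G v u → C u ≢ B) →
                              B ≢ C v → Distinguishing (Recolouring.recoloured c w≢v w~v B-free)
  recoloured-distinguishing {v} {w} {B} w≢v w~v B-free B≢Cv σ pres = dc σ c-pres
    where
      open Recolouring c w≢v w~v B-free
      σw-colour : recolour (to σ w) ≡ C v
      σw-colour = trans (pres w) (trans (recolour-off w≢v) w~v)
      σw-colour-if-v-moves : to σ v ≢ v → recolour (to σ w) ≡ B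
      σw-colour-if-v-moves σv≢v with to σ w ≟ v
      ... | yes σw≡v = trans (cong recolour σw≡v) recolour-v
      ... | no σw≢v = trans (recolour-off σw≢v) (trans (automorphism-respects-classes σ w~v)
                        (trans (sym (recolour-off σv≢v)) (trans (pres v) recolour-v)))
      fixes-v : to σ v ≡ v
      fixes-v with to σ v ≟ v
      ... | yes σv≡v = σv≡v
      ... | no σv≢v = ⊥-elim (B≢Cv (trans (sym (σw-colour-if-v-moves σv≢v)) σw-colour))
      c-pres : PreservesClasses c σ
      c-pres i with i ≟ v
      ... | yes refl = cong C fixes-v
      ... | no i≢v = trans (sym (recolour-off σi≢v)) (trans (pres i) (recolour-off i≢v))
        where
          σi≢v : to σ i ≢ v
          σi≢v σi≡v = i≢v (to-injective σ (trans σi≡v (sym fixes-v)))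

  shared-class⇒no-free-colour : ∀ {v w B} → w ≢ v → C w ≡ C v → B ≢ C v →
                                ¬ (∀ {u} → Adj G v u → C u ≢ B)
  shared-class⇒no-free-colour {v} {w} {B} w≢v w~v B≢Cv B-free = B≢Cv (begin
    B            ≡⟨ sym recolour-v ⟩
    recolour v   ≡⟨ sym (proj₁ (unique c recoloured dc d-dist w v) w~v) ⟩
    recolour w   ≡⟨ recolour-off w≢v ⟩
    C w          ≡⟨ w~v ⟩
    C v          ∎)
    where
      open Recolouring c w≢v w~v B-free
      d-dist : Distinguishing recoloured
      d-dist = recoloured-distinguishing w≢v w~v B-free B≢Cv

merge : ∀ {k} {a b : Fin (suc k)} → a ≢ b → Fin (suc k) → Fin k
merge {b = b} a≢b x with b ≟ x
... | yes _ = punchOut (a≢b ∘ sym)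
... | no b≢x = punchOut b≢x

merge-punchIn : ∀ {k} {a b : Fin (suc k)} (a≢b : a ≢ b) j → merge a≢b (punchIn b j) ≡ j
merge-punchIn {b = b} a≢b j with b ≟ punchIn b j
... | yes b≡b′ = ⊥-elim (punchInᵢ≢i b j (sym b≡b′))
... | no _ = trans (punchOut-cong b refl) (punchOut-punchIn b)

merge-fibres : ∀ {k} {a b : Fin (suc k)} (a≢b : a ≢ b) x y → merge a≢b x ≡ merge a≢b y →
               x ≡ y ⊎ (x ≡ a × y ≡ b) ⊎ (x ≡ b × y ≡ a)
merge-fibres {b = b} a≢b x y e with b ≟ x | b ≟ y
... | yes refl | yes refl = inj₁ refl
... | yes refl | no b≢y = inj₂ (inj₂ (refl , sym (punchOut-injective (a≢b ∘ sym) b≢y e)))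
... | no b≢x | yes refl = inj₂ (inj₁ (punchOut-injective b≢x (a≢b ∘ sym) e , refl))
... | no b≢x | no b≢y = inj₁ (punchOut-injective b≢x b≢y e)

module Merging {n} {G : Graph n} {k} (c : Coloring G (suc k)) {x y : Fin n}
  (x-alone : ∀ {w} → col c w ≡ col c x → w ≡ x) (y-alone : ∀ {w} → col c w ≡ col c y → w ≡ y)
  (x≢y : x ≢ y) (x≁y : ¬ Adj G x y) where

  private
    C : Fin n → Fin (suc k)
    C = col c

    Cx≢Cy : C x ≢ C y
    Cx≢Cy e = x≢y (sym (x-alone (sym e)))

  merged : Coloring G k
  merged = record
    { col    = merge Cx≢Cy ∘ C
    ; onto   = λ j → let (i , ci≡j) = onto c (punchIn (C y) j) in
                     i , trans (cong (merge Cx≢Cy) ci≡j) (merge-punchIn Cx≢Cy j)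
    ; proper = proper′
    }
    where
      proper′ : ∀ i j → Adj G i j → merge Cx≢Cy (C i) ≢ merge Cx≢Cy (C j)
      proper′ i j a e with merge-fibres Cx≢Cy (C i) (C j) e
      ... | inj₁ ci≡cj = proper c i j a ci≡cj
      ... | inj₂ (inj₁ (ci≡cx , cj≡cy)) = x≁y (subst₂ (Adj G) (x-alone ci≡cx) (y-alone cj≡cy) a)
      ... | inj₂ (inj₂ (ci≡cy , cj≡cx)) = x≁y (subst₂ (Adj G) (x-alone cj≡cx) (y-alone ci≡cy) (adj-sym G a))

  merged-classes : ∀ {i j} → col merged i ≡ col merged j → C i ≡ C j ⊎ (i ≡ x × j ≡ y) ⊎ (i ≡ y × j ≡ x)
  merged-classes {i} {j} e with merge-fibres Cx≢Cy (C i) (C j) e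
  ... | inj₁ ci≡cj = inj₁ ci≡cj
  ... | inj₂ (inj₁ (ci≡cx , cj≡cy)) = inj₂ (inj₁ (x-alone ci≡cx , y-alone cj≡cy))
  ... | inj₂ (inj₂ (ci≡cy , cj≡cx)) = inj₂ (inj₂ (y-alone ci≡cy , x-alone cj≡cx))

  merged-preserves-off : ∀ σ → PreservesClasses merged σ → ∀ {i} → i ≢ x → i ≢ y → C (to σ i) ≡ C i
  merged-preserves-off σ pres {i} i≢x i≢y with merged-classes (pres i)
  ... | inj₁ e = e
  ... | inj₂ (inj₁ (_ , i≡y)) = ⊥-elim (i≢y i≡y)
  ... | inj₂ (inj₂ (_ , i≡x)) = ⊥-elim (i≢x i≡x)

  merged-distinguishing : Distinguishing c →
                          (∀ σ → PreservesClasses merged σ → to σ x ≢ y) →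
                          (∀ σ → PreservesClasses merged σ → to σ y ≢ x) →
                          Distinguishing merged
  merged-distinguishing dc x↛y y↛x σ pres = dc σ c-pres
    where
      c-pres : PreservesClasses c σ
      c-pres i with merged-classes (pres i)
      ... | inj₁ e = e
      ... | inj₂ (inj₁ (σi≡x , refl)) = ⊥-elim (y↛x σ pres σi≡x)
      ... | inj₂ (inj₂ (σi≡y , refl)) = ⊥-elim (x↛y σ pres σi≡y)

record Leaf {n} (G : Graph n) (ℓ p : Fin n) : Set where
  field
    attached : Adj G ℓ p
    only-neighbour : ∀ {u} → Adj G ℓ u → u ≡ p
open Leaf

record DistantLeaves {n} (G : Graph n) : Set where
  field
    ℓ₁ p₁ ℓ₂ p₂ : Fin n
    leaf₁ : Leaf G ℓ₁ p₁
    leaf₂ : Leaf G ℓ₂ p₂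
    p₁≢p₂ : p₁ ≢ p₂
    ℓ₁≁ℓ₂ : ¬ Adj G ℓ₁ ℓ₂

another-colour : ∀ {k} (a b : Fin (3 + k)) → ∃ λ B → B ≢ a × B ≢ b
another-colour Fin.zero Fin.zero = Fin.suc Fin.zero , (λ ()) , (λ ())
another-colour Fin.zero (Fin.suc Fin.zero) = Fin.suc (Fin.suc Fin.zero) , (λ ()) , (λ ())
another-colour Fin.zero (Fin.suc (Fin.suc _)) = Fin.suc Fin.zero , (λ ()) , (λ ())
another-colour (Fin.suc Fin.zero) Fin.zero = Fin.suc (Fin.suc Fin.zero) , (λ ()) , (λ ())
another-colour (Fin.suc _) (Fin.suc _) = Fin.zero , (λ ()) , (λ ())
another-colour (Fin.suc (Fin.suc _)) Fin.zero = Fin.suc Fin.zero , (λ ()) , (λ ())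

module AtLeastThreeColours {n} {G : Graph n} {k} (c : Coloring G (3 + k)) (dc : Distinguishing c)
  (unique : UniqueDistPartition G (3 + k)) where

  open UniquePartition c dc unique

  private
    C : Fin n → Fin (3 + k)
    C = col c

  -- A third colour is free at a leaf: it avoids the leaf's own colour and its parent's.
  leaf-alone : ∀ {ℓ p} → Leaf G ℓ p → ∀ {w} → C w ≡ C ℓ → w ≡ ℓ
  leaf-alone {ℓ} {p} leaf {w} w~ℓ with w ≟ ℓ | another-colour (C ℓ) (C p)
  ... | yes w≡ℓ | _ = w≡ℓ
  ... | no w≢ℓ | B , B≢Cℓ , B≢Cp = ⊥-elim (shared-class⇒no-free-colour w≢ℓ w~ℓ B≢Cℓ
          λ a Cu≡B → B≢Cp (trans (sym Cu≡B) (cong C (only-neighbour leaf a))))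

  -- σ carries p to p′, so p′ shares the class of p while the class of ℓ′ is free at p.
  leaf-swap-absurd : ∀ {ℓ p ℓ′ p′} → Leaf G ℓ p → Leaf G ℓ′ p′ → p ≢ p′ → ¬ Adj G ℓ ℓ′ →
                     (σ : Automorphism G) → to σ ℓ ≡ ℓ′ → C (to σ p) ≡ C p → ⊥
  leaf-swap-absurd {ℓ} {p} {ℓ′} {p′} leaf leaf′ p≢p′ ℓ≁ℓ′ σ σℓ≡ℓ′ σp~p =
    shared-class⇒no-free-colour (p≢p′ ∘ sym) p′~p Cℓ′≢Cp ℓ′-colour-free
    where
      σp≡p′ : to σ p ≡ p′
      σp≡p′ = only-neighbour leaf′ (subst (λ z → Adj G z (to σ p)) σℓ≡ℓ′ (trans (preserves σ ℓ p) (attached leaf)))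
      p′~p : C p′ ≡ C p
      p′~p = trans (cong C (sym σp≡p′)) σp~p
      Cℓ′≢Cp : C ℓ′ ≢ C p
      Cℓ′≢Cp e = ℓ≁ℓ′ (subst (Adj G ℓ) (leaf-alone leaf′ (sym e)) (attached leaf))
      ℓ′-colour-free : ∀ {u} → Adj G p u → C u ≢ C ℓ′
      ℓ′-colour-free a e = p≢p′ (only-neighbour leaf′ (adj-sym G (subst (Adj G _) (leaf-alone leaf′ e) a)))

  merge-distant-leaves : DistantLeaves G → HasDistColoring G (2 + k)
  merge-distant-leaves record { ℓ₁ = ℓ₁ ; p₁ = p₁ ; ℓ₂ = ℓ₂ ; p₂ = p₂ ; leaf₁ = leaf₁ ; leaf₂ = leaf₂
                              ; p₁≢p₂ = p₁≢p₂ ; ℓ₁≁ℓ₂ = ℓ₁≁ℓ₂ } =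
    merged , merged-distinguishing dc
      (λ σ pres σℓ₁≡ℓ₂ → leaf-swap-absurd leaf₁ leaf₂ p₁≢p₂ ℓ₁≁ℓ₂ σ σℓ₁≡ℓ₂
                           (merged-preserves-off σ pres p₁≢ℓ₁ p₁≢ℓ₂))
      (λ σ pres σℓ₂≡ℓ₁ → leaf-swap-absurd leaf₂ leaf₁ (p₁≢p₂ ∘ sym) (ℓ₁≁ℓ₂ ∘ adj-sym G) σ σℓ₂≡ℓ₁
                           (merged-preserves-off σ pres p₂≢ℓ₁ p₂≢ℓ₂))
    where
      ℓ₁≢ℓ₂ : ℓ₁ ≢ ℓ₂
      ℓ₁≢ℓ₂ refl = p₁≢p₂ (only-neighbour leaf₂ (attached leaf₁))
      p₁≢ℓ₁ : p₁ ≢ ℓ₁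
      p₁≢ℓ₁ = adj⇒≢ G (attached leaf₁) ∘ sym
      p₁≢ℓ₂ : p₁ ≢ ℓ₂
      p₁≢ℓ₂ refl = ℓ₁≁ℓ₂ (attached leaf₁)
      p₂≢ℓ₁ : p₂ ≢ ℓ₁
      p₂≢ℓ₁ refl = ℓ₁≁ℓ₂ (adj-sym G (attached leaf₂))
      p₂≢ℓ₂ : p₂ ≢ ℓ₂
      p₂≢ℓ₂ = adj⇒≢ G (attached leaf₂) ∘ sym
      open Merging c (leaf-alone leaf₁) (leaf-alone leaf₂) ℓ₁≢ℓ₂ ℓ₁≁ℓ₂

distant-leaves-absurd : ∀ {n} {G : Graph n} {k} → ChiD≡ G k → 3 ≤ k → UniqueDistPartition G k →
                        ¬ DistantLeaves G
distant-leaves-absurd {k = 0} _ () _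
distant-leaves-absurd {k = 1} _ (s≤s ()) _
distant-leaves-absurd {k = 2} _ (s≤s (s≤s ())) _
distant-leaves-absurd {k = suc (suc (suc k))} ((c , dc) , minimal) _ unique leaves =
  minimal (2 + k) ≤-refl (merge-distant-leaves leaves)
  where open AtLeastThreeColours c dc unique

module Paths {n} (G : Graph n) where

  record Path : Set where
    field
      len : ℕ
      vertex : ℕ → Fin n
      injective : ∀ {i j} → i ≤ len → j ≤ len → vertex i ≡ vertex j → i ≡ j
      adjacent : ∀ i → i < len → Adj G (vertex i) (vertex (suc i))
  open Path public

  len<n : (P : Path) → len P < n
  len<n P = ≰⇒> λ n≤len → let (i , j , i<j , e) = pigeonhole (s≤s n≤len) (vertex P ∘ toℕ) in
    <⇒≢ i<j (injective P (s≤s⁻¹ (toℕ<n i)) (s≤s⁻¹ (toℕ<n j)) e)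

  reverse : Path → Path
  reverse P = record
    { len = len P
    ; vertex = λ i → vertex P (len P ∸ i)
    ; injective = λ {i} {j} i≤ j≤ e → ∸-cancelˡ-≡ i≤ j≤ (injective P (m∸n≤m (len P) i) (m∸n≤m (len P) j) e)
    ; adjacent = reversed-adjacent
    }
    where
      reversed-adjacent : ∀ i → i < len P → Adj G (vertex P (len P ∸ i)) (vertex P (len P ∸ suc i))
      reversed-adjacent i i<len = subst (λ m → Adj G (vertex P m) (vertex P (len P ∸ suc i)))
                           (sym (+-∸-assoc 1 i<len))
                           (adj-sym G (adjacent P (len P ∸ suc i) (∸-monoʳ-< z<s i<len)))

  single : Fin n → Path
  single v = record { len = 0 ; vertex = const v ; injective = λ { z≤n z≤n _ → refl } ; adjacent = λ _ () }

  Fresh : Path → Fin n → Set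
  Fresh P u = ∀ t → t ≤ len P → vertex P t ≢ u

  extend : (P : Path) (u : Fin n) → Adj G u (vertex P 0) → Fresh P u → Path
  extend P u a fresh = record { len = suc (len P) ; vertex = vertex′ ; injective = injective′ ; adjacent = adjacent′ }
    where
      vertex′ : ℕ → Fin n
      vertex′ zero = u
      vertex′ (suc t) = vertex P t
      injective′ : ∀ {i j} → i ≤ suc (len P) → j ≤ suc (len P) → vertex′ i ≡ vertex′ j → i ≡ j
      injective′ {zero} {zero} _ _ _ = refl
      injective′ {zero} {suc j} _ (s≤s j≤) e = ⊥-elim (fresh j j≤ (sym e))
      injective′ {suc i} {zero} (s≤s i≤) _ e = ⊥-elim (fresh i i≤ e)
      injective′ {suc i} {suc j} (s≤s i≤) (s≤s j≤) e = cong suc (injective P i≤ j≤ e)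
      adjacent′ : ∀ i → i < suc (len P) → Adj G (vertex′ i) (vertex′ (suc i))
      adjacent′ zero _ = a
      adjacent′ (suc i) (s≤s i<len) = adjacent P i i<len

  chord⇒cycle : (P : Path) → ∀ i L → i + suc (suc L) ≤ len P →
                Adj G (vertex P i) (vertex P (i + suc (suc L))) → HasCycle G
  chord⇒cycle P i L bound chord = L , vertex P ∘ (i +_) ∘ toℕ , injective′ , adjacent′
    where
      on-path : (t : Fin (3 + L)) → i + toℕ t ≤ len P
      on-path t = ≤-trans (+-monoʳ-≤ i (s≤s⁻¹ (toℕ<n t))) bound
      injective′ : ∀ {s t} → vertex P (i + toℕ s) ≡ vertex P (i + toℕ t) → s ≡ t
      injective′ {s} {t} e = toℕ-injective (+-cancelˡ-≡ i _ _ (injective P (on-path s) (on-path t) e))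
      adjacent′ : ∀ t → Adj G (vertex P (i + toℕ t)) (vertex P (i + toℕ (succMod (3 + L) t)))
      adjacent′ t = subst (λ r → Adj G (vertex P (i + toℕ t)) (vertex P (i + r)))
                          (sym (toℕ-fromℕ< (m%n<n (suc (toℕ t)) (3 + L))))
                          (next (toℕ t) (toℕ<n t))
        where
          next : ∀ s → s < 3 + L → Adj G (vertex P (i + s)) (vertex P (i + suc s % (3 + L)))
          next s s<3+L with m≤n⇒m<n∨m≡n (s≤s⁻¹ s<3+L)
          ... | inj₁ s<2+L = subst (λ r → Adj G (vertex P (i + s)) (vertex P r))
                                   (trans (sym (+-suc i s)) (cong (i +_) (sym (m<n⇒m%n≡m (s≤s s<2+L)))))
                                   (adjacent P (i + s) (subst (_≤ len P) (+-suc i s) (≤-trans (+-monoʳ-≤ i s<2+L) bound)))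
          ... | inj₂ refl = subst (λ r → Adj G (vertex P (i + suc (suc L))) (vertex P r))
                                  (trans (sym (+-identityʳ i)) (cong (i +_) (sym (n%n≡0 (3 + L)))))
                                  (adj-sym G chord)

  OnPath : Path → Fin n → Set
  OnPath P u = ∃ λ (t : Fin (suc (len P))) → vertex P (toℕ t) ≡ u

  onPath? : (P : Path) → ∀ u → Dec (OnPath P u)
  onPath? P u = any? λ t → vertex P (toℕ t) ≟ u

  ¬onPath⇒fresh : ∀ P {u} → ¬ OnPath P u → Fresh P u
  ¬onPath⇒fresh P ¬on t t≤ e = ¬on (fromℕ< (s≤s t≤) , trans (cong (vertex P) (toℕ-fromℕ< (s≤s t≤))) e)

  FrontClosed : Path → Set
  FrontClosed P = ∀ {u} → Adj G (vertex P 0) u → OnPath P u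

  front-leaf : ¬ HasCycle G → (P : Path) → 1 ≤ len P → FrontClosed P → Leaf G (vertex P 0) (vertex P 1)
  front-leaf acyclic P 1≤len closed = record { attached = adjacent P 0 1≤len ; only-neighbour = only }
    where
      only : ∀ {u} → Adj G (vertex P 0) u → u ≡ vertex P 1
      only {u} a with closed a
      ... | t , vt≡u with toℕ t | toℕ<n t
      ...   | zero | _ = ⊥-elim (adj⇒≢ G a vt≡u)
      ...   | suc zero | _ = sym vt≡u
      ...   | suc (suc L) | t<1+len = ⊥-elim (acyclic (chord⇒cycle P 0 L (s≤s⁻¹ t<1+len) (subst (Adj G _) (sym vt≡u) a)))

  Extendable : Path → Set
  Extendable P = ∃ λ u → Adj G (vertex P 0) u × ¬ OnPath P u

  extendable? : (P : Path) → Dec (Extendable P)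
  extendable? P = any? λ u → adj? G (vertex P 0) u ×-dec ¬? (onPath? P u)

  ¬extendable⇒closed : ∀ P → ¬ Extendable P → FrontClosed P
  ¬extendable⇒closed P stuck {u} a = decidable-stable (onPath? P u) λ ¬on → stuck (u , a , ¬on)

  extend-by : (P : Path) → Extendable P → Path
  extend-by P (u , a , ¬on) = extend P u (adj-sym G a) (¬onPath⇒fresh P ¬on)

  Maximal : Path → Set
  Maximal P = FrontClosed P × FrontClosed (reverse P)

  grown : ∀ {m} → (Σ Path λ Q → suc m ≤ len Q × Maximal Q) → Σ Path λ Q → m ≤ len Q × Maximal Q
  grown (Q , m<len , maximal) = Q , ≤-trans (n≤1+n _) m<len , maximal

  -- Every extension lengthens the path, and len < n, so the fuel never runs out.
  maximal-path : (fuel : ℕ) (P : Path) → n ≤ len P + fuel → Σ Path λ Q → len P ≤ len Q × Maximal Q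
  maximal-path zero P n≤ = ⊥-elim (<⇒≱ (len<n P) (subst (n ≤_) (+-identityʳ _) n≤))
  maximal-path (suc fuel) P n≤ with extendable? P | extendable? (reverse P)
  ... | yes e | _ = grown (maximal-path fuel (extend-by P e) (subst (n ≤_) (+-suc _ fuel) n≤))
  ... | no _ | yes e = grown (maximal-path fuel (extend-by (reverse P) e) (subst (n ≤_) (+-suc _ fuel) n≤))
  ... | no stuck | no stuck′ = P , ≤-refl , (¬extendable⇒closed P stuck , ¬extendable⇒closed (reverse P) stuck′)

  maximal-path⇒distant-leaves : ¬ HasCycle G → (P : Path) → 3 ≤ len P → Maximal P → DistantLeaves G
  maximal-path⇒distant-leaves acyclic P 3≤len (closed , closed′) = record
    { ℓ₁ = vertex P 0 ; p₁ = vertex P 1 ; ℓ₂ = vertex P (len P) ; p₂ = vertex P (len P ∸ 1)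
    ; leaf₁ = front-leaf acyclic P 1≤len closed
    ; leaf₂ = front-leaf acyclic (reverse P) 1≤len closed′
    ; p₁≢p₂ = λ e → 1≢2+o (trans (injective P 1≤len (m∸n≤m (len P) 1) e) (cong (_∸ 1) (sym len≡3+o)))
    ; ℓ₁≁ℓ₂ = λ a → acyclic (chord⇒cycle P 0 (suc o) (≤-reflexive len≡3+o)
                                (subst (λ m → Adj G (vertex P 0) (vertex P m)) (sym len≡3+o) a))
    }
    where
      o : ℕ
      o = proj₁ (m≤n⇒∃[o]m+o≡n 3≤len)
      len≡3+o : 3 + o ≡ len P
      len≡3+o = proj₂ (m≤n⇒∃[o]m+o≡n 3≤len)
      1≤len : 1 ≤ len P
      1≤len = ≤-trans (s≤s z≤n) 3≤len
      1≢2+o : 1 ≢ 2 + o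
      1≢2+o ()

module Stars {n} (G : Graph n) where

  open Paths G

  triangle⇒cycle : ∀ {a b c} → Adj G a b → Adj G b c → Adj G c a → HasCycle G
  triangle⇒cycle {a} {b} {c} ab bc ca = chord⇒cycle (extend b-c a ab a-fresh) 0 0 ≤-refl (adj-sym G ca)
    where
      b-c : Path
      b-c = extend (single c) b bc (λ _ _ → adj⇒≢ G bc ∘ sym)
      a-fresh : Fresh b-c a
      a-fresh zero _ = adj⇒≢ G ab ∘ sym
      a-fresh (suc zero) _ = adj⇒≢ G ca
      a-fresh (suc (suc _)) (s≤s ())

  IsP₄ : Fin n → Fin n → Fin n → Fin n → Set
  IsP₄ a b x e = Adj G a b × Adj G b x × Adj G x e × a ≢ x × b ≢ e × a ≢ e

  HasP₄ : Set
  HasP₄ = ∃ λ a → ∃ λ b → ∃ λ x → ∃ λ e → IsP₄ a b x e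

  hasP₄? : Dec HasP₄
  hasP₄? = any? λ a → any? λ b → any? λ x → any? λ e →
    adj? G a b ×-dec adj? G b x ×-dec adj? G x e ×-dec ¬? (a ≟ x) ×-dec ¬? (b ≟ e) ×-dec ¬? (a ≟ e)

  p₄-path : ∀ {a b x e} → IsP₄ a b x e → Path
  p₄-path {a} {b} {x} {e} (ab , bx , xe , a≢x , b≢e , a≢e) = extend b-x-e a ab a-fresh
    where
      x-e : Path
      x-e = extend (single e) x xe (λ _ _ → adj⇒≢ G xe ∘ sym)
      b-fresh : Fresh x-e b
      b-fresh zero _ = adj⇒≢ G bx ∘ sym
      b-fresh (suc zero) _ = b≢e ∘ sym
      b-fresh (suc (suc _)) (s≤s ())
      b-x-e : Path
      b-x-e = extend x-e b bx b-fresh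
      a-fresh : Fresh b-x-e a
      a-fresh zero _ = adj⇒≢ G ab ∘ sym
      a-fresh (suc zero) _ = a≢x ∘ sym
      a-fresh (suc (suc zero)) _ = a≢e ∘ sym
      a-fresh (suc (suc (suc _))) (s≤s (s≤s ()))

  walk₃⇒cycle-or-P₄ : ∀ {y z w w′} → Adj G y z → Adj G z w → Adj G w w′ → y ≢ w → z ≢ w′ → HasCycle G ⊎ HasP₄
  walk₃⇒cycle-or-P₄ {y} {z} {w} {w′} yz zw ww′ y≢w z≢w′ with y ≟ w′
  ... | yes refl = inj₁ (triangle⇒cycle yz zw ww′)
  ... | no y≢w′ = inj₂ (y , z , w , w′ , yz , zw , ww′ , y≢w , z≢w′ , y≢w′)

  centre⇒star : ∀ z → Connected G → (∀ {w w′} → Adj G z w → Adj G w w′ → w′ ≡ z) → IsStar G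
  centre⇒star z connected pendant = z , λ i j → edge-at-z i j , z-adjacent i j
    where
      along : ∀ {u v} → Walk G u v → u ≡ z ⊎ Adj G z u → v ≡ z ⊎ Adj G z v
      along here near-u = near-u
      along (step a r) (inj₁ refl) = along r (inj₂ a)
      along (step a r) (inj₂ zu) = along r (inj₁ (pendant zu a))
      near : ∀ v → v ≡ z ⊎ Adj G z v
      near v = along (connected z v) (inj₁ refl)
      edge-at-z : ∀ i j → Adj G i j → i ≡ z ⊎ j ≡ z
      edge-at-z i j a with near i
      ... | inj₁ i≡z = inj₁ i≡z
      ... | inj₂ zi = inj₂ (pendant zi a)
      z-adjacent : ∀ i j → i ≡ z ⊎ j ≡ z → i ≢ j → Adj G i j
      z-adjacent i j (inj₁ refl) i≢j with near j
      ... | inj₁ j≡z = ⊥-elim (i≢j (sym j≡z))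
      ... | inj₂ zj = zj
      z-adjacent i j (inj₂ refl) i≢j with near i
      ... | inj₁ i≡z = ⊥-elim (i≢j i≡z)
      ... | inj₂ zi = adj-sym G zi

  -- The centre is z₀ itself if it has two neighbours or none, and its unique neighbour otherwise.
  no-P₄⇒star : Fin n → Connected G → ¬ HasCycle G → ¬ HasP₄ → IsStar G
  no-P₄⇒star z₀ connected acyclic no-P₄
    with any? (λ y₁ → any? λ y₂ → adj? G z₀ y₁ ×-dec adj? G z₀ y₂ ×-dec ¬? (y₁ ≟ y₂)) | any? (adj? G z₀)
  ... | yes (y₁ , y₂ , zy₁ , zy₂ , y₁≢y₂) | _ = centre⇒star z₀ connected z₀-pendant
    where
      escape : ∀ {y w w′} → Adj G z₀ y → Adj G z₀ w → Adj G w w′ → y ≢ w → w′ ≢ z₀ → ⊥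
      escape zy zw ww′ y≢w w′≢z = [ acyclic , no-P₄ ]′
        (walk₃⇒cycle-or-P₄ (adj-sym G zy) zw ww′ y≢w (w′≢z ∘ sym))
      z₀-pendant : ∀ {w w′} → Adj G z₀ w → Adj G w w′ → w′ ≡ z₀
      z₀-pendant {w} {w′} zw ww′ with w′ ≟ z₀ | y₁ ≟ w
      ... | yes w′≡z | _ = w′≡z
      ... | no w′≢z | yes refl = ⊥-elim (escape zy₂ zw ww′ (y₁≢y₂ ∘ sym) w′≢z)
      ... | no w′≢z | no y₁≢w = ⊥-elim (escape zy₁ zw ww′ y₁≢w w′≢z)
  ... | no _ | no isolated = centre⇒star z₀ connected λ zw _ → ⊥-elim (isolated (_ , zw))
  ... | no ¬two | yes (y₀ , zy₀) = centre⇒star y₀ connected y₀-pendant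
    where
      only-y₀ : ∀ {u} → Adj G z₀ u → u ≡ y₀
      only-y₀ {u} zu with u ≟ y₀
      ... | yes u≡y₀ = u≡y₀
      ... | no u≢y₀ = ⊥-elim (¬two (u , y₀ , zu , zy₀ , u≢y₀))
      y₀-pendant : ∀ {w w′} → Adj G y₀ w → Adj G w w′ → w′ ≡ y₀
      y₀-pendant {w} {w′} yw ww′ with w′ ≟ y₀ | w ≟ z₀
      ... | yes w′≡y₀ | _ = w′≡y₀
      ... | no _ | yes refl = only-y₀ ww′
      ... | no w′≢y₀ | no w≢z₀ = ⊥-elim ([ acyclic , no-P₄ ]′
              (walk₃⇒cycle-or-P₄ zy₀ yw ww′ (w≢z₀ ∘ sym) (w′≢y₀ ∘ sym)))

  star-or-distant-leaves : IsTree G → IsStar G ⊎ DistantLeaves G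
  star-or-distant-leaves (0<n , connected , acyclic) with hasP₄?
  ... | no no-P₄ = inj₁ (no-P₄⇒star (fromℕ< 0<n) connected acyclic no-P₄)
  ... | yes (_ , _ , _ , _ , p₄) with maximal-path n (p₄-path p₄) (m≤n+m n 3)
  ...   | Q , 3≤len , maximal = inj₂ (maximal-path⇒distant-leaves acyclic Q 3≤len maximal)

theorem4p5 : ∀ {n} (T : Graph n) (k : ℕ) → IsTree T → UniquelyDistColorable T → ChiD≡ T k → 3 ≤ k → IsStar T
theorem4p5 T k tree (k′ , χD≡k′ , unique) χD≡k 3≤k with χD-unique χD≡k′ χD≡k | Stars.star-or-distant-leaves T tree
... | _ | inj₁ star = star
... | refl | inj₂ leaves = ⊥-elim (distant-leaves-absurd χD≡k 3≤k unique leaves)
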